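{- For all integers $a,b\geq 1$ there exists a shiftable $SMR(4b,8ab;4a,2)$.
   Context: A signed magic rectangle $SMR(m,n;r,s)$ is an $m\times n$ array, some of whose cells are filled with integers and the others empty, such that exactly $r$ cells in every row and exactly $s$ cells in every column are filled (so $mr=ns$), every element of $X$ appears exactly once in the array, and the sum of the entries of each row and of each column is zero, where (for $mr$ even) $X=\{\pm1,\pm2,\ldots,\pm mr/2\}$. An array is shiftable if every row and every column contains the same number of positive entries as negative entries. -}

module Defs where

import Data.Nat
open import Data.Nat using (ℕ; zero; suc; _*_; _≤_; _/_)
import Data.Integer as ℤ
open import Data.Integer using (ℤ; +_; -_; ∣_∣)
import Data.Fin
open import Data.Fin using (Fin)
open import Data.Maybe using (Maybe; just; nothing)
open import Data.Bool using (Bool; true; false; if_then_else_)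
open import Data.Product using (_×_; Σ; ∃; _,_)
open import Data.Sum using (_⊎_)
open import Relation.Binary.PropositionalEquality using (_≡_; _≢_)
open import Relation.Nullary.Decidable using (⌊_⌋)

count : {n : ℕ} → (Fin n → Bool) → ℕ
count {zero} p = 0
count {suc n} p = (if p Data.Fin.zero then 1 else 0) Data.Nat.+ count (λ i → p (Data.Fin.suc i))

sumℤ : {n : ℕ} → (Fin n → ℤ) → ℤ
sumℤ {zero} f = + 0
sumℤ {suc n} f = f Data.Fin.zero ℤ.+ sumℤ (λ i → f (Data.Fin.suc i))

-- A partially filled m × n array: nothing = empty cell.
Array : ℕ → ℕ → Set
Array m n = Fin m → Fin n → Maybe ℤ

isFilled : Maybe ℤ → Bool
isFilled (just _) = true
isFilled nothing  = false

isPos : Maybe ℤ → Bool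
isPos (just x) = ⌊ + 0 ℤ.<? x ⌋
isPos nothing  = false

isNeg : Maybe ℤ → Bool
isNeg (just x) = ⌊ x ℤ.<? + 0 ⌋
isNeg nothing  = false

val : Maybe ℤ → ℤ
val (just x) = x
val nothing  = + 0

InX : ℕ → ℤ → Set
InX N x = x ≢ + 0 × ∣ x ∣ ≤ N

-- Signed magic rectangle SMR(m,n;r,s) (for m*r even), X = {±1,…,±(m*r/2)}.
record IsSMR (m n r s : ℕ) (A : Array m n) : Set where
  field
    rowFilled : ∀ i → count (λ j → isFilled (A i j)) ≡ r
    colFilled : ∀ j → count (λ i → isFilled (A i j)) ≡ s
    entriesInX : ∀ i j x → A i j ≡ just x → InX ((m * r) / 2) x
    allOfXOccur : ∀ x → InX ((m * r) / 2) x → Σ (Fin m) λ i → Σ (Fin n) λ j → A i j ≡ just x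
    occurOnce : ∀ i j i′ j′ x → A i j ≡ just x → A i′ j′ ≡ just x → (i ≡ i′ × j ≡ j′)
    rowSum : ∀ i → sumℤ (λ j → val (A i j)) ≡ + 0
    colSum : ∀ j → sumℤ (λ i → val (A i j)) ≡ + 0

record IsShiftable {m n : ℕ} (A : Array m n) : Set where
  field
    rowBalanced : ∀ i → count (λ j → isPos (A i j)) ≡ count (λ j → isNeg (A i j))
    colBalanced : ∀ j → count (λ i → isPos (A i j)) ≡ count (λ i → isNeg (A i j))

-- Cut the 8ab columns into 2b blocks of 4a consecutive columns and the 4b rows into 2b pairs.
-- The k-th pair of rows is filled exactly on the k-th block, column j holding +(j+1) in one row of
-- the pair and −(j+1) in the other, so every column is balanced and sums to zero.  Along a row the
-- signs repeat + − − + (reversed in the odd row of the pair); this pattern has two signs of each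
-- kind and kills every four consecutive values: (m+1) − (m+2) − (m+3) + (m+4) = 0.
module Submission where

open import Algebra.Bundles using (Monoid)
open import Data.Bool using (Bool; true; false; not; _xor_; if_then_else_)
open import Data.Bool.Properties using (xor-assoc; xor-same; xor-identityʳ)
open import Data.Fin using (Fin; toℕ; fromℕ<)
open import Data.Fin.Properties using (toℕ<n; toℕ-fromℕ<; toℕ-injective)
import Data.Integer as ℤ
open import Data.Integer using (ℤ; +_; -[1+_])
import Data.Integer.Properties as ℤ
import Data.Integer.Tactic.RingSolver as ℤ-Solver
open import Data.Maybe using (Maybe; just; nothing)
open import Data.Maybe.Properties using (just-injective)
open import Data.Nat
open import Data.Nat.DivMod
open import Data.Nat.Divisibility using (divides-refl)
open import Data.Nat.Properties
open import Data.Nat.Tactic.RingSolver using (solve-∀)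
open import Data.Product using (Σ; _×_; _,_)
open import Function using (_∘_; case_of_)
open import Relation.Binary.PropositionalEquality
  using (_≡_; _≢_; refl; sym; trans; cong; cong₂; subst; module ≡-Reasoning)
open import Relation.Nullary.Decidable using (does; yes; no; dec-true; dec-false)

open import Defs

module RangeSum {c ℓ} (M : Monoid c ℓ) where
  open Monoid M renaming (refl to ≈-refl; sym to ≈-sym; trans to ≈-trans)
  open import Relation.Binary.Reasoning.Setoid setoid

  Σ< : ℕ → (ℕ → Carrier) → Carrier
  Σ< zero    f = ε
  Σ< (suc n) f = f 0 ∙ Σ< n (f ∘ suc)

  Σ<-cong : ∀ n {f g} → (∀ {k} → k < n → f k ≈ g k) → Σ< n f ≈ Σ< n g
  Σ<-cong zero    f≈g = ≈-refl
  Σ<-cong (suc n) f≈g = ∙-cong (f≈g z<s) (Σ<-cong n (f≈g ∘ s<s))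

  Σ<-ε : ∀ n {f} → (∀ {k} → k < n → f k ≈ ε) → Σ< n f ≈ ε
  Σ<-ε zero    f≈ε = ≈-refl
  Σ<-ε (suc n) f≈ε = ≈-trans (∙-cong (f≈ε z<s) (Σ<-ε n (f≈ε ∘ s<s))) (identityˡ ε)

  Σ<-+ : ∀ m n f → Σ< (m + n) f ≈ Σ< m f ∙ Σ< n (λ k → f (m + k))
  Σ<-+ zero    n f = ≈-sym (identityˡ _)
  Σ<-+ (suc m) n f = begin
    f 0 ∙ Σ< (m + n) (f ∘ suc)                        ≈⟨ ∙-congˡ (Σ<-+ m n (f ∘ suc)) ⟩
    f 0 ∙ (Σ< m (f ∘ suc) ∙ Σ< n (λ k → f (suc m + k))) ≈⟨ ≈-sym (assoc _ _ _) ⟩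
    Σ< (suc m) f ∙ Σ< n (λ k → f (suc m + k))          ∎

  Σ<-* : ∀ q n f → Σ< (q * n) f ≈ Σ< q (λ k → Σ< n (λ t → f (k * n + t)))
  Σ<-* zero    n f = ≈-refl
  Σ<-* (suc q) n f = begin
    Σ< (n + q * n) f                                       ≈⟨ Σ<-+ n (q * n) f ⟩
    Σ< n f ∙ Σ< (q * n) (λ k → f (n + k))                  ≈⟨ ∙-congˡ (Σ<-* q n _) ⟩
    Σ< n f ∙ Σ< q (λ k → Σ< n (λ t → f (n + (k * n + t))))
      ≈⟨ ∙-congˡ (Σ<-cong q λ _ → Σ<-cong n λ _ → reflexive (cong f (sym (+-assoc n _ _)))) ⟩
    Σ< (suc q) (λ k → Σ< n (λ t → f (k * n + t)))          ∎

  Σ<-single : ∀ {q c} f → c < q → (∀ {k} → k < q → k ≢ c → f k ≈ ε) → Σ< q f ≈ f c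
  Σ<-single {suc q} {zero} f _ f≈ε = begin
    f 0 ∙ Σ< q (f ∘ suc) ≈⟨ ∙-congˡ (Σ<-ε q λ k<q → f≈ε (s<s k<q) λ ()) ⟩
    f 0 ∙ ε              ≈⟨ identityʳ (f 0) ⟩
    f 0                  ∎
  Σ<-single {suc q} {suc c} f (s<s c<q) f≈ε = begin
    f 0 ∙ Σ< q (f ∘ suc) ≈⟨ ∙-cong (f≈ε z<s λ ()) (Σ<-single (f ∘ suc) c<q λ k<q k≢c →
                                                      f≈ε (s<s k<q) (k≢c ∘ suc-injective)) ⟩
    ε ∙ f (suc c)        ≈⟨ identityˡ (f (suc c)) ⟩
    f (suc c)            ∎

module ℕΣ = RangeSum +-0-monoid
module ℤΣ = RangeSum ℤ.+-0-monoid

bit : Bool → ℕ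
bit b = if b then 1 else 0

count≡Σ< : ∀ n (p : ℕ → Bool) → count {n} (p ∘ toℕ) ≡ ℕΣ.Σ< n (bit ∘ p)
count≡Σ< zero    p = refl
count≡Σ< (suc n) p = cong (λ n → bit (p 0) + n) (count≡Σ< n (p ∘ suc))

sumℤ≡Σ< : ∀ n (f : ℕ → ℤ) → sumℤ {n} (f ∘ toℕ) ≡ ℤΣ.Σ< n f
sumℤ≡Σ< zero    f = refl
sumℤ≡Σ< (suc n) f = cong (λ x → f 0 ℤ.+ x) (sumℤ≡Σ< n (f ∘ suc))

Σ<-ones : ∀ n → ℕΣ.Σ< n (λ _ → 1) ≡ n
Σ<-ones zero    = refl
Σ<-ones (suc n) = cong suc (Σ<-ones n)

[m*n+o]/n≡m : ∀ m {n o} .{{_ : NonZero n}} → o < n → (m * n + o) / n ≡ m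
[m*n+o]/n≡m m {n} {o} o<n = begin
  (m * n + o) / n   ≡⟨ +-distrib-/-∣ˡ o (divides-refl m) ⟩
  m * n / n + o / n ≡⟨ cong₂ _+_ (m*n/n≡m m n) (m<n⇒m/n≡0 o<n) ⟩
  m + 0             ≡⟨ +-identityʳ m ⟩
  m                 ∎
  where open ≡-Reasoning

[m*n+o]%n≡o : ∀ m {n o} .{{_ : NonZero n}} → o < n → (m * n + o) % n ≡ o
[m*n+o]%n≡o m {n} {o} o<n = begin
  (m * n + o) % n ≡⟨ cong (_% n) (+-comm (m * n) o) ⟩
  (o + m * n) % n ≡⟨ [m+kn]%n≡m%n o m n ⟩
  o % n           ≡⟨ m<n⇒m%n≡m o<n ⟩
  o               ∎
  where open ≡-Reasoning

signed : Bool → ℕ → ℤ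
signed true  j = + suc j
signed false j = -[1+ j ]

signed-injective : ∀ {s s′ j j′} → signed s j ≡ signed s′ j′ → s ≡ s′ × j ≡ j′
signed-injective {true}  {true}  refl = refl , refl
signed-injective {false} {false} refl = refl , refl

signed≢0 : ∀ s j → signed s j ≢ + 0
signed≢0 true  j ()
signed≢0 false j ()

∣signed∣ : ∀ s j → ℤ.∣ signed s j ∣ ≡ suc j
∣signed∣ true  j = refl
∣signed∣ false j = refl

signed-surjective : ∀ {x} → x ≢ + 0 → Σ Bool λ s → Σ ℕ λ j → signed s j ≡ x
signed-surjective {+ zero}  x≢0 = case x≢0 refl of λ ()
signed-surjective {+ suc j} _   = true , j , refl
signed-surjective { -[1+ j ]} _ = false , j , refl

isPos-signed : ∀ s j → isPos (just (signed s j)) ≡ s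
isPos-signed true  j = refl
isPos-signed false j = refl

isNeg-signed : ∀ s j → isNeg (just (signed s j)) ≡ not s
isNeg-signed true  j = refl
isNeg-signed false j = refl

signed-not-cancel : ∀ s j → signed s j ℤ.+ signed (not s) j ≡ + 0
signed-not-cancel true  j = ℤ.+-inverseʳ (+ suc j)
signed-not-cancel false j = ℤ.+-inverseˡ (+ suc j)

quartet : ℕ → Bool
quartet 0 = true
quartet 1 = false
quartet 2 = false
quartet 3 = true
quartet (suc (suc (suc (suc n)))) = quartet n

quartet-periodic : ∀ u v → quartet (u * 4 + v) ≡ quartet v
quartet-periodic zero    v = refl
quartet-periodic (suc u) v = quartet-periodic u v

quartet-balanced : ∀ e → ℕΣ.Σ< 4 (λ v → bit (e xor quartet v))
                       ≡ ℕΣ.Σ< 4 (λ v → bit (not (e xor quartet v)))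
quartet-balanced true  = refl
quartet-balanced false = refl

withSign : Bool → ℤ → ℤ
withSign true  = λ x → x
withSign false = ℤ.-_

signed-+ : ∀ s m n → signed s (m + n) ≡ withSign s (+ m ℤ.+ + suc n)
signed-+ true  m n = trans (cong +_ (sym (+-suc m n))) (ℤ.pos-+ m (suc n))
signed-+ false m n = cong ℤ.-_ (signed-+ true m n)

quartet-cancels : ∀ e m → ℤΣ.Σ< 4 (λ v → signed (e xor quartet v) (m + v)) ≡ + 0
quartet-cancels e m = trans (ℤΣ.Σ<-cong 4 λ {v} _ → signed-+ (e xor quartet v) m v) (cancels e (+ m))
  where
  cancels : ∀ e x → ℤΣ.Σ< 4 (λ v → withSign (e xor quartet v) (x ℤ.+ + suc v)) ≡ + 0
  cancels false = +−−+
    where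
    +−−+ : ∀ x → x ℤ.+ + 1 ℤ.+ (ℤ.- (x ℤ.+ + 2) ℤ.+ (ℤ.- (x ℤ.+ + 3) ℤ.+ (x ℤ.+ + 4 ℤ.+ + 0))) ≡ + 0
    +−−+ = ℤ-Solver.solve-∀
  cancels true = −++−
    where
    −++− : ∀ x → ℤ.- (x ℤ.+ + 1) ℤ.+ (x ℤ.+ + 2 ℤ.+ (x ℤ.+ + 3 ℤ.+ (ℤ.- (x ℤ.+ + 4) ℤ.+ + 0))) ≡ + 0
    −++− = ℤ-Solver.solve-∀

Σ<-quartet-cancels : ∀ a e m → ℤΣ.Σ< (4 * a) (λ t → signed (e xor quartet t) (m + t)) ≡ + 0
Σ<-quartet-cancels a e m = begin
  ℤΣ.Σ< (4 * a) (λ t → signed (e xor quartet t) (m + t))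
    ≡⟨ cong (λ n → ℤΣ.Σ< n (λ t → signed (e xor quartet t) (m + t))) (*-comm 4 a) ⟩
  ℤΣ.Σ< (a * 4) (λ t → signed (e xor quartet t) (m + t))
    ≡⟨ ℤΣ.Σ<-* a 4 _ ⟩
  ℤΣ.Σ< a (λ u → ℤΣ.Σ< 4 (λ v → signed (e xor quartet (u * 4 + v)) (m + (u * 4 + v))))
    ≡⟨ ℤΣ.Σ<-ε a (λ {u} _ → trans (ℤΣ.Σ<-cong 4 λ {v} _ → shift u v) (quartet-cancels e (m + u * 4))) ⟩
  + 0 ∎
  where
  open ≡-Reasoning
  shift : ∀ u v → signed (e xor quartet (u * 4 + v)) (m + (u * 4 + v))
                ≡ signed (e xor quartet v) (m + u * 4 + v)
  shift u v = cong₂ (λ σ n → signed (e xor σ) n) (quartet-periodic u v) (sym (+-assoc m (u * 4) v))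

Σ<-quartet-balanced : ∀ a e → ℕΣ.Σ< (4 * a) (λ t → bit (e xor quartet t))
                            ≡ ℕΣ.Σ< (4 * a) (λ t → bit (not (e xor quartet t)))
Σ<-quartet-balanced a e = begin
  ℕΣ.Σ< (4 * a) (λ t → bit (e xor quartet t))                  ≡⟨ periodic (λ σ → bit (e xor σ)) ⟩
  ℕΣ.Σ< a (λ _ → ℕΣ.Σ< 4 (λ v → bit (e xor quartet v)))       ≡⟨ cong (λ n → ℕΣ.Σ< a λ _ → n) (quartet-balanced e) ⟩
  ℕΣ.Σ< a (λ _ → ℕΣ.Σ< 4 (λ v → bit (not (e xor quartet v)))) ≡⟨ periodic (λ σ → bit (not (e xor σ))) ⟨
  ℕΣ.Σ< (4 * a) (λ t → bit (not (e xor quartet t)))            ∎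
  where
  open ≡-Reasoning
  periodic : ∀ g → ℕΣ.Σ< (4 * a) (g ∘ quartet) ≡ ℕΣ.Σ< a (λ _ → ℕΣ.Σ< 4 (g ∘ quartet))
  periodic g = begin
    ℕΣ.Σ< (4 * a) (g ∘ quartet)                                 ≡⟨ cong (λ n → ℕΣ.Σ< n (g ∘ quartet)) (*-comm 4 a) ⟩
    ℕΣ.Σ< (a * 4) (g ∘ quartet)                                 ≡⟨ ℕΣ.Σ<-* a 4 _ ⟩
    ℕΣ.Σ< a (λ u → ℕΣ.Σ< 4 (λ v → g (quartet (u * 4 + v))))
      ≡⟨ ℕΣ.Σ<-cong a (λ {u} _ → ℕΣ.Σ<-cong 4 λ {v} _ → cong g (quartet-periodic u v)) ⟩
    ℕΣ.Σ< a (λ _ → ℕΣ.Σ< 4 (g ∘ quartet))                       ∎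

bit<2 : ∀ b → bit b < 2
bit<2 true  = s<s z<s
bit<2 false = z<s

odd : ℕ → Bool
odd i = i % 2 ≡ᵇ 1

odd[m*2+bit[b]] : ∀ m b → odd (m * 2 + bit b) ≡ b
odd[m*2+bit[b]] m b = trans (cong (_≡ᵇ 1) ([m*n+o]%n≡o m (bit<2 b))) (bit≡ᵇ1 b)
  where
  bit≡ᵇ1 : ∀ b → (bit b ≡ᵇ 1) ≡ b
  bit≡ᵇ1 true  = refl
  bit≡ᵇ1 false = refl

m≡m/2*2+bit[odd[m]] : ∀ m → m ≡ m / 2 * 2 + bit (odd m)
m≡m/2*2+bit[odd[m]] m = begin
  m                       ≡⟨ m≡m%n+[m/n]*n m 2 ⟩
  m % 2 + m / 2 * 2       ≡⟨ +-comm (m % 2) _ ⟩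
  m / 2 * 2 + m % 2       ≡⟨ cong (λ r → m / 2 * 2 + r) (r≡bit[r≡ᵇ1] (m%n<n m 2)) ⟩
  m / 2 * 2 + bit (odd m) ∎
  where
  open ≡-Reasoning
  r≡bit[r≡ᵇ1] : ∀ {r} → r < 2 → r ≡ bit (r ≡ᵇ 1)
  r≡bit[r≡ᵇ1] {0} _ = refl
  r≡bit[r≡ᵇ1] {1} _ = refl
  r≡bit[r≡ᵇ1] {2+ _} (s<s (s<s ()))

xor-cancelʳ : ∀ x y → (x xor y) xor y ≡ x
xor-cancelʳ x y = trans (xor-assoc x y y) (trans (cong (x xor_) (xor-same y)) (xor-identityʳ x))

m<q⇒m*n+o<q*n : ∀ {m n o q} → m < q → o < n → m * n + o < q * n
m<q⇒m*n+o<q*n {m} {n} {o} {q} m<q o<n = begin-strict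
  m * n + o ≡⟨ +-comm (m * n) o ⟩
  o + m * n <⟨ +-monoˡ-< (m * n) o<n ⟩
  suc m * n ≤⟨ *-monoˡ-≤ n m<q ⟩
  q * n     ∎
  where open ≤-Reasoning

module Construction (a b : ℕ) .{{_ : NonZero a}} where

  width blocks rows columns : ℕ
  width   = 4 * a
  blocks  = 2 * b
  rows    = 4 * b
  columns = 8 * a * b

  instance
    width-nonZero : NonZero width
    width-nonZero = m*n≢0 4 a

  rows≡blocks*2 : rows ≡ blocks * 2
  rows≡blocks*2 = identity b
    where
    identity : ∀ b → 4 * b ≡ 2 * b * 2
    identity = solve-∀

  columns≡blocks*width : columns ≡ blocks * width
  columns≡blocks*width = identity a b
    where
    identity : ∀ a b → 8 * a * b ≡ 2 * b * (4 * a)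
    identity = solve-∀

  rows*width/2≡columns : rows * width / 2 ≡ columns
  rows*width/2≡columns = trans (cong (_/ 2) (identity a b)) (m*n/n≡m columns 2)
    where
    identity : ∀ a b → 4 * b * (4 * a) ≡ 8 * a * b * 2
    identity = solve-∀

  block : ℕ → ℕ
  block j = j / width

  columnSign : ℕ → Bool
  columnSign j = quartet (j % width)

  entry : ℕ → ℕ → Maybe ℤ
  entry i j = if does (block j ≟ i / 2) then just (signed (odd i xor columnSign j) j) else nothing

  rowOf : Bool → ℕ → ℕ
  rowOf s j = block j * 2 + bit (s xor columnSign j)

  array : Array rows columns
  array i j = entry (toℕ i) (toℕ j)

  entry-inside : ∀ {i j} → block j ≡ i / 2 → entry i j ≡ just (signed (odd i xor columnSign j) j)
  entry-inside {i} {j} eq rewrite dec-true (block j ≟ i / 2) eq = refl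

  entry-outside : ∀ {i j} → block j ≢ i / 2 → entry i j ≡ nothing
  entry-outside {i} {j} neq rewrite dec-false (block j ≟ i / 2) neq = refl

  entry-just : ∀ {i j x} → entry i j ≡ just x → block j ≡ i / 2 × signed (odd i xor columnSign j) j ≡ x
  entry-just {i} {j} eq with block j ≟ i / 2
  ... | yes inside  = inside , just-injective (trans (sym (entry-inside {i} inside)) eq)
  ... | no  outside = case trans (sym (entry-outside {i} outside)) eq of λ ()

  block<blocks : ∀ {j} → j < columns → block j < blocks
  block<blocks {j} j< = m<n*o⇒m/o<n (subst (j <_) columns≡blocks*width j<)

  half<blocks : ∀ {i} → i < rows → i / 2 < blocks
  half<blocks {i} i< = m<n*o⇒m/o<n (subst (i <_) rows≡blocks*2 i<)

  rowOf<rows : ∀ s {j} → j < columns → rowOf s j < rows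
  rowOf<rows s {j} j< =
    subst (rowOf s j <_) (sym rows≡blocks*2) (m<q⇒m*n+o<q*n (block<blocks j<) (bit<2 _))

  entry-rowOf : ∀ s j → entry (rowOf s j) j ≡ just (signed s j)
  entry-rowOf s j = begin
    entry (rowOf s j) j
      ≡⟨ entry-inside {rowOf s j} (sym ([m*n+o]/n≡m (block j) (bit<2 oddRow))) ⟩
    just (signed (odd (rowOf s j) xor columnSign j) j)
      ≡⟨ cong (λ o → just (signed (o xor columnSign j) j)) (odd[m*2+bit[b]] (block j) oddRow) ⟩
    just (signed (oddRow xor columnSign j) j)
      ≡⟨ cong (λ s′ → just (signed s′ j)) (xor-cancelʳ s (columnSign j)) ⟩
    just (signed s j)
      ∎
    where
    open ≡-Reasoning
    oddRow : Bool
    oddRow = s xor columnSign j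

  entry-position : ∀ {i j s j′} → entry i j ≡ just (signed s j′) → i ≡ rowOf s j′ × j ≡ j′
  entry-position {i} {j} eq with entry-just {i} eq
  ... | inside , same with signed-injective same
  ... | refl , refl = row , refl
    where
    open ≡-Reasoning
    row : i ≡ rowOf (odd i xor columnSign j) j
    row = begin
      i
        ≡⟨ m≡m/2*2+bit[odd[m]] i ⟩
      i / 2 * 2 + bit (odd i)
        ≡⟨ cong₂ (λ k o → k * 2 + bit o) (sym inside) (sym (xor-cancelʳ (odd i) (columnSign j))) ⟩
      block j * 2 + bit ((odd i xor columnSign j) xor columnSign j)
        ∎

  module LineSums {c ℓ} (M : Monoid c ℓ) (φ : Maybe ℤ → Monoid.Carrier M)
                  (φ-nothing : Monoid._≈_ M (φ nothing) (Monoid.ε M)) where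
    open Monoid M using (_≈_; _∙_; ε; ∙-congˡ; identityʳ; reflexive; setoid)
      renaming (trans to ≈-trans)
    open RangeSum M
    open import Relation.Binary.Reasoning.Setoid setoid

    row-Σ : ∀ {i} → i < rows → Σ< columns (λ j → φ (entry i j))
                             ≈ Σ< width (λ t → φ (just (signed (odd i xor quartet t) (i / 2 * width + t))))
    row-Σ {i} i< = begin
      Σ< columns (φ ∘ entry i)                          ≡⟨ cong (λ n → Σ< n (φ ∘ entry i)) columns≡blocks*width ⟩
      Σ< (blocks * width) (φ ∘ entry i)                 ≈⟨ Σ<-* blocks width _ ⟩
      Σ< blocks (λ k → Σ< width (λ t → φ (entry i (k * width + t))))
                                                        ≈⟨ Σ<-single _ (half<blocks i<) outside ⟩
      Σ< width (λ t → φ (entry i (i / 2 * width + t)))  ≈⟨ Σ<-cong width inside ⟩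
      Σ< width (λ t → φ (just (signed (odd i xor quartet t) (i / 2 * width + t)))) ∎
      where
      outside : ∀ {k} → k < blocks → k ≢ i / 2 → Σ< width (λ t → φ (entry i (k * width + t))) ≈ ε
      outside {k} _ k≢ = Σ<-ε width λ t< →
        ≈-trans (reflexive (cong φ (entry-outside {i} (k≢ ∘ trans (sym ([m*n+o]/n≡m k t<)))))) φ-nothing
      inside : ∀ {t} → t < width → φ (entry i (i / 2 * width + t))
                                 ≈ φ (just (signed (odd i xor quartet t) (i / 2 * width + t)))
      inside {t} t< = reflexive (cong φ (trans (entry-inside {i} ([m*n+o]/n≡m (i / 2) t<))
        (cong (λ r → just (signed (odd i xor quartet r) (i / 2 * width + t))) ([m*n+o]%n≡o (i / 2) t<))))

    column-Σ : ∀ {j} → j < columns → Σ< rows (λ i → φ (entry i j))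
                                   ≈ φ (just (signed (columnSign j) j)) ∙ φ (just (signed (not (columnSign j)) j))
    column-Σ {j} j< = begin
      Σ< rows (λ i → φ (entry i j))                      ≡⟨ cong (λ n → Σ< n (λ i → φ (entry i j))) rows≡blocks*2 ⟩
      Σ< (blocks * 2) (λ i → φ (entry i j))              ≈⟨ Σ<-* blocks 2 _ ⟩
      Σ< blocks (λ k → Σ< 2 (λ e → φ (entry (k * 2 + e) j)))
                                                         ≈⟨ Σ<-single _ (block<blocks j<) outside ⟩
      Σ< 2 (λ e → φ (entry (block j * 2 + e) j))         ≈⟨ Σ<-cong 2 inside ⟩
      Σ< 2 (λ e → φ (just (signed ((e ≡ᵇ 1) xor columnSign j) j)))
                                                         ≈⟨ ∙-congˡ (identityʳ _) ⟩
      φ (just (signed (columnSign j) j)) ∙ φ (just (signed (not (columnSign j)) j)) ∎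
      where
      outside : ∀ {k} → k < blocks → k ≢ block j → Σ< 2 (λ e → φ (entry (k * 2 + e) j)) ≈ ε
      outside {k} _ k≢ = Σ<-ε 2 λ e< →
        ≈-trans (reflexive (cong φ (entry-outside {k * 2 + _} λ eq → k≢ (sym (trans eq ([m*n+o]/n≡m k e<))))))
                φ-nothing
      inside : ∀ {e} → e < 2 → φ (entry (block j * 2 + e) j)
                             ≈ φ (just (signed ((e ≡ᵇ 1) xor columnSign j) j))
      inside {e} e< = reflexive (cong φ (trans
        (entry-inside {block j * 2 + e} (sym ([m*n+o]/n≡m (block j) e<)))
        (cong (λ r → just (signed ((r ≡ᵇ 1) xor columnSign j) j)) ([m*n+o]%n≡o (block j) e<))))

  module Filled   = LineSums +-0-monoid (bit ∘ isFilled) refl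
  module Positive = LineSums +-0-monoid (bit ∘ isPos) refl
  module Negative = LineSums +-0-monoid (bit ∘ isNeg) refl
  module Values   = LineSums ℤ.+-0-monoid val refl

  row-filled : ∀ i → count (λ j → isFilled (array i j)) ≡ width
  row-filled i = trans (count≡Σ< columns _) (trans (Filled.row-Σ (toℕ<n i)) (Σ<-ones width))

  column-filled : ∀ j → count (λ i → isFilled (array i j)) ≡ 2
  column-filled j = trans (count≡Σ< rows _) (Filled.column-Σ (toℕ<n j))

  row-sum : ∀ i → sumℤ (λ j → val (array i j)) ≡ + 0
  row-sum i = begin
    sumℤ (λ j → val (array i j))                                      ≡⟨ sumℤ≡Σ< columns _ ⟩
    ℤΣ.Σ< columns (λ j → val (entry (toℕ i) j))                        ≡⟨ Values.row-Σ (toℕ<n i) ⟩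
    ℤΣ.Σ< width (λ t → signed (odd (toℕ i) xor quartet t) (toℕ i / 2 * width + t))
      ≡⟨ Σ<-quartet-cancels a (odd (toℕ i)) (toℕ i / 2 * width) ⟩
    + 0                                                               ∎
    where open ≡-Reasoning

  column-sum : ∀ j → sumℤ (λ i → val (array i j)) ≡ + 0
  column-sum j = trans (sumℤ≡Σ< rows _)
    (trans (Values.column-Σ (toℕ<n j)) (signed-not-cancel (columnSign (toℕ j)) (toℕ j)))

  row-balanced : ∀ i → count (λ j → isPos (array i j)) ≡ count (λ j → isNeg (array i j))
  row-balanced i = begin
    count (λ j → isPos (array i j))                                    ≡⟨ count≡Σ< columns _ ⟩
    ℕΣ.Σ< columns (λ j → bit (isPos (entry (toℕ i) j)))                ≡⟨ Positive.row-Σ (toℕ<n i) ⟩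
    ℕΣ.Σ< width (λ t → bit (isPos (just (signed (e xor quartet t) (m + t)))))
      ≡⟨ ℕΣ.Σ<-cong width (λ {t} _ → cong bit (isPos-signed (e xor quartet t) (m + t))) ⟩
    ℕΣ.Σ< width (λ t → bit (e xor quartet t))                          ≡⟨ Σ<-quartet-balanced a e ⟩
    ℕΣ.Σ< width (λ t → bit (not (e xor quartet t)))
      ≡⟨ ℕΣ.Σ<-cong width (λ {t} _ → cong bit (isNeg-signed (e xor quartet t) (m + t))) ⟨
    ℕΣ.Σ< width (λ t → bit (isNeg (just (signed (e xor quartet t) (m + t)))))
      ≡⟨ Negative.row-Σ (toℕ<n i) ⟨
    ℕΣ.Σ< columns (λ j → bit (isNeg (entry (toℕ i) j)))                ≡⟨ count≡Σ< columns _ ⟨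
    count (λ j → isNeg (array i j))                                    ∎
    where
    open ≡-Reasoning
    e : Bool
    e = odd (toℕ i)
    m : ℕ
    m = toℕ i / 2 * width

  column-balanced : ∀ j → count (λ i → isPos (array i j)) ≡ count (λ i → isNeg (array i j))
  column-balanced j = begin
    count (λ i → isPos (array i j))                       ≡⟨ count≡Σ< rows _ ⟩
    ℕΣ.Σ< rows (λ i → bit (isPos (entry i (toℕ j))))      ≡⟨ Positive.column-Σ (toℕ<n j) ⟩
    ind isPos σ + ind isPos (not σ)                       ≡⟨ pair σ ⟩
    ind isNeg σ + ind isNeg (not σ)                       ≡⟨ Negative.column-Σ (toℕ<n j) ⟨
    ℕΣ.Σ< rows (λ i → bit (isNeg (entry i (toℕ j))))      ≡⟨ count≡Σ< rows _ ⟨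
    count (λ i → isNeg (array i j))                       ∎
    where
    open ≡-Reasoning
    σ : Bool
    σ = columnSign (toℕ j)
    ind : (Maybe ℤ → Bool) → Bool → ℕ
    ind p s = bit (p (just (signed s (toℕ j))))
    pair : ∀ s → ind isPos s + ind isPos (not s) ≡ ind isNeg s + ind isNeg (not s)
    pair true  = refl
    pair false = refl

  signed-in-X : ∀ s {j} → j < columns → InX (rows * width / 2) (signed s j)
  signed-in-X s {j} j< = signed≢0 s j , (begin
    ℤ.∣ signed s j ∣  ≡⟨ ∣signed∣ s j ⟩
    suc j             ≤⟨ j< ⟩
    columns           ≡⟨ rows*width/2≡columns ⟨
    rows * width / 2  ∎)
    where open ≤-Reasoning

  entries-in-X : ∀ i j x → array i j ≡ just x → InX (rows * width / 2) x
  entries-in-X i j x eq with entry-just {toℕ i} eq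
  ... | _ , refl = signed-in-X _ (toℕ<n j)

  all-occur : ∀ x → InX (rows * width / 2) x →
              Σ (Fin rows) λ i → Σ (Fin columns) λ j → array i j ≡ just x
  all-occur x (x≢0 , ∣x∣≤) with signed-surjective x≢0
  ... | s , j , refl = fromℕ< (rowOf<rows s j<) , fromℕ< j< ,
                       trans (cong₂ entry (toℕ-fromℕ< (rowOf<rows s j<)) (toℕ-fromℕ< j<)) (entry-rowOf s j)
    where
    j< : j < columns
    j< = subst (suc j ≤_) rows*width/2≡columns (subst (_≤ rows * width / 2) (∣signed∣ s j) ∣x∣≤)

  occur-once : ∀ i j i′ j′ x → array i j ≡ just x → array i′ j′ ≡ just x → i ≡ i′ × j ≡ j′
  occur-once i j i′ j′ x eq eq′ with entry-just {toℕ i} eq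
  ... | _ , refl with entry-position {toℕ i} eq | entry-position {toℕ i′} eq′
  ... | i≡ , _ | i′≡ , j′≡ = toℕ-injective (trans i≡ (sym i′≡)) , toℕ-injective (sym j′≡)

lemma11 : (a b : ℕ) → a ≥ 1 → b ≥ 1 →
    Σ (Array (4 * b) (8 * a * b)) λ A → IsSMR (4 * b) (8 * a * b) (4 * a) 2 A × IsShiftable A
lemma11 a b a≥1 _ = array , isSMR , isShiftable
  where
  instance _ = >-nonZero a≥1
  open Construction a b

  isSMR : IsSMR rows columns width 2 array
  isSMR = record
    { rowFilled   = row-filled
    ; colFilled   = column-filled
    ; entriesInX  = entries-in-X
    ; allOfXOccur = all-occur
    ; occurOnce   = occur-once
    ; rowSum      = row-sum
    ; colSum      = column-sum
    }

  isShiftable : IsShiftable array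
  isShiftable = record { rowBalanced = row-balanced ; colBalanced = column-balanced }
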